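{- Let $n\ge 2$ and $0\le k\le n$. The double discriminant $DD_{n,k}$ is a homogeneous and quasi-homogeneous polynomial in the variables $\{a_0,\ldots,a_n\}\setminus\{a_k\}$: every term $c\prod_{i\neq k}a_i^{e_i}$ (with $c\neq 0$) satisfies \[\sum_{i\ne k} e_i=\begin{cases}(3n-6)(n-1), & k\in\{0,n\},\\ (3n-4)(n-1), & 0<k<n,\end{cases}\qquad \sum_{i\neq k} i\,e_i=\begin{cases} n(n-1)(2n-4), & k=0,\\ n(n-1)(2n-k-2), & 0<k\le n.\end{cases}\]
   Context: Let $a_0,\ldots,a_n$ be independent indeterminates, $f(x)=\sum_{i=0}^n a_ix^i$, and let $D_n\in\mathbb{Z}[a_0,\ldots,a_n]$ be its discriminant (normalized so that for $f=a_n\prod_{i=1}^n(x-r_i)$, $D_n=a_n^{2n-2}\prod_{i<j}(r_i-r_j)^2$). The double discriminant is $DD_{n,k}=\operatorname{disc}_{a_k}(D_n)\in\mathbb{Z}[a_i: i\neq k]$, the discriminant of $D_n$ regarded as a polynomial in the single variable $a_k$ over $\mathbb{Z}[a_i:i\ne k]$ (of degree $d=\deg_{a_k}D_n$, which is $n-1$ for $k\in\{0,n\}$ and $n$ otherwise), using the same normalization: for a polynomial $g$ of degree $d$ with leading coefficient $c$ and roots $\rho_1,\ldots,\rho_d$, $\operatorname{disc} g=c^{2d-2}\prod_{i<j}(\rho_i-\rho_j)^2$. -}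

module Defs where

open import Data.Nat as ℕ using (ℕ; zero; suc; _∸_; _≤ᵇ_; _<ᵇ_; _≡ᵇ_)
open import Data.Nat.DivMod using (_/_)
open import Data.Integer as ℤ using (ℤ; +_; -1ℤ)
open import Data.Fin as Fin using (Fin; toℕ)
open import Data.Vec as Vec using (Vec; []; _∷_; lookup; zipWith; updateAt; replicate; _[_]≔_)
open import Data.Vec.Properties using (≡-dec)
open import Data.List as List using (List; concatMap; upTo; allFin)
open import Data.Bool using (Bool; true; false; if_then_else_; _∨_; _∧_; not)
open import Relation.Nullary using (does; yes; no)
open import Relation.Binary.PropositionalEquality using (_≡_)

-- Polynomials over ℤ in the variables x_0, …, x_{m-1}, represented by
-- their coefficient function: (p e) is the coefficient of the monomial
-- ∏ x_i ^ (lookup e i).  Only finitely supported functions arise below.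

Poly : ℕ → Set
Poly m = Vec ℕ m → ℤ

below : ∀ {m} → Vec ℕ m → List (Vec ℕ m)
below []      = List.[ [] ]
below (x ∷ e) = concatMap (λ i → List.map (i ∷_) (below e)) (upTo (suc x))

isZeroVec : ∀ {m} → Vec ℕ m → Bool
isZeroVec []      = true
isZeroVec (x ∷ e) = (x ≡ᵇ 0) ∧ isZeroVec e

0P : ∀ {m} → Poly m
0P _ = + 0

constP : ∀ {m} → ℤ → Poly m
constP c e = if isZeroVec e then c else + 0

1P : ∀ {m} → Poly m
1P = constP (+ 1)

varP : ∀ {m} → Fin m → Poly m
varP {m} i e = if does (≡-dec ℕ._≟_ e (replicate m 0 [ i ]≔ 1)) then + 1 else + 0

_+P_ : ∀ {m} → Poly m → Poly m → Poly m
(p +P q) e = p e ℤ.+ q e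

_·P_ : ∀ {m} → ℤ → Poly m → Poly m
(c ·P p) e = c ℤ.* p e

_*P_ : ∀ {m} → Poly m → Poly m → Poly m
(p *P q) e = List.foldr ℤ._+_ (+ 0) (List.map (λ e′ → p e′ ℤ.* q (zipWith _∸_ e e′)) (below e))
infixl 6 _+P_
infixl 7 _*P_ _·P_

_≈P_ : ∀ {m} → Poly m → Poly m → Set
p ≈P q = ∀ e → p e ≡ q e

-- Determinants (Laplace expansion along the first row) of N×N matrices
-- with entries in Poly m, indexed by ℕ (only indices < N are used).

sumP : ∀ {m} → List (Poly m) → Poly m
sumP = List.foldr _+P_ 0P

minor : ∀ {m} → (ℕ → ℕ → Poly m) → ℕ → (ℕ → ℕ → Poly m)
minor M j r c = M (suc r) (if c <ᵇ j then c else suc c)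

det : ∀ {m} → ℕ → (ℕ → ℕ → Poly m) → Poly m
det zero    M = 1P
det (suc N) M =
  sumP (List.map (λ j → (-1ℤ ℤ.^ j) ·P (M 0 j *P det N (minor M j))) (upTo (suc N)))

-- Univariate polynomials over Poly m: a coefficient sequence g (g j is the
-- coefficient of y^j) together with a formal degree d.

-- Sylvester matrix of g (degree d) and h (degree e), size (e + d):
-- the first e rows contain the coefficients of g (highest first, shifted),
-- the last d rows those of h.
sylvester : ∀ {m} → ℕ → (ℕ → Poly m) → ℕ → (ℕ → Poly m) → ℕ → ℕ → Poly m
sylvester d g e h r c =
  if r <ᵇ e
  then (if (r ≤ᵇ c) ∧ ((c ∸ r) ≤ᵇ d) then g (d ∸ (c ∸ r)) else 0P)
  else (if ((r ∸ e) ≤ᵇ c) ∧ ((c ∸ (r ∸ e)) ≤ᵇ e) then h (e ∸ (c ∸ (r ∸ e))) else 0P)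

resultant : ∀ {m} → ℕ → (ℕ → Poly m) → ℕ → (ℕ → Poly m) → Poly m
resultant d g e h = det (e ℕ.+ d) (sylvester d g e h)

deriv : ∀ {m} → (ℕ → Poly m) → (ℕ → Poly m)
deriv g j = (+ (suc j)) ·P g (suc j)

discSign : ℕ → ℤ
discSign d = -1ℤ ℤ.^ ((d ℕ.* (d ∸ 1)) / 2)

-- Q is the discriminant of g (degree d, leading coefficient g d):
--   g_d · Q = (-1)^(d(d-1)/2) · Res(g, g′).
-- Over the integral domain ℤ[x] (with g_d ≠ 0) this determines Q uniquely and
-- agrees with  g_d^(2d-2) ∏_{i<j} (ρ_i - ρ_j)^2.
IsDisc : ∀ {m} → ℕ → (ℕ → Poly m) → Poly m → Set
IsDisc d g Q = (g d *P Q) ≈P (discSign d ·P resultant d g (d ∸ 1) (deriv g))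

-- The generic polynomial f = Σ_{i ≤ n} a_i x^i, with a_i = variable i of
-- Poly (suc n).

genericCoeff : (n : ℕ) → ℕ → Poly (suc n)
genericCoeff n i with i ℕ.<? suc n
... | yes i<  = varP (Fin.fromℕ< i<)
... | no  _   = 0P

bumpLast : ∀ {n} → Vec ℕ (suc n) → Vec ℕ (suc n)
bumpLast {n} e = updateAt e (Fin.fromℕ n) suc

-- D_n = (-1)^(n(n-1)/2) · Res(f, f′) / a_n   (exact division by the variable a_n)
D : (n : ℕ) → Poly (suc n)
D n e = (discSign n ·P resultant n (genericCoeff n) (n ∸ 1) (deriv (genericCoeff n))) (bumpLast e)

-- coefficient of a_k^j in p, as a polynomial in the remaining variables
-- (kept in Poly (suc n) with a_k-exponent 0)
coeffIn : ∀ {n} → Fin (suc n) → Poly (suc n) → ℕ → Poly (suc n)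
coeffIn k p j e = if lookup e k ≡ᵇ 0 then p (e [ k ]≔ j) else + 0

isEnd : (n : ℕ) → Fin (suc n) → Bool
isEnd n k = (toℕ k ≡ᵇ 0) ∨ (toℕ k ≡ᵇ n)

degD : (n : ℕ) → Fin (suc n) → ℕ
degD n k = if isEnd n k then n ∸ 1 else n

IsDD : (n : ℕ) → Fin (suc n) → Poly (suc n) → Set
IsDD n k Q = IsDisc (degD n k) (coeffIn k (D n)) Q

sumFin : ∀ {N} → (Fin N → ℕ) → ℕ
sumFin {N} f = List.foldr ℕ._+_ 0 (List.map f (allFin N))

degOff : ∀ {n} → Fin (suc n) → Vec ℕ (suc n) → ℕ
degOff k e = sumFin (λ i → if does (i Fin.≟ k) then 0 else lookup e i)

weightOff : ∀ {n} → Fin (suc n) → Vec ℕ (suc n) → ℕ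
weightOff k e = sumFin (λ i → if does (i Fin.≟ k) then 0 else toℕ i ℕ.* lookup e i)

expectedDeg : (n : ℕ) → Fin (suc n) → ℕ
expectedDeg n k = if isEnd n k then (3 ℕ.* n ∸ 6) ℕ.* (n ∸ 1) else (3 ℕ.* n ∸ 4) ℕ.* (n ∸ 1)

expectedWeight : (n : ℕ) → Fin (suc n) → ℕ
expectedWeight n k =
  if toℕ k ≡ᵇ 0 then n ℕ.* (n ∸ 1) ℕ.* (2 ℕ.* n ∸ 4)
  else n ℕ.* (n ∸ 1) ℕ.* (2 ℕ.* n ∸ toℕ k ∸ 2)

{-# OPTIONS --safe #-}
-- Give the variable a_i the weight α + β·i (α = 1, β = 0 is the total degree, α = 0, β = 1 the
-- weight Σ i·e_i).  The (r, s) entry of the Sylvester matrix of the generic f and f′ is a multiple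
-- of a_{n+r-s} or of a_{r-s+1}, so its weight has the form ρ_r - σ_s, and the determinant of such a
-- matrix is homogeneous of weight Σ ρ_r - Σ σ_s.  Hence Res(f, f′), and with it
-- D_n = ±Res(f, f′)/a_n, is homogeneous of weight (2n-2)α + n(n-1)β.  Writing D_n = Σ_j g_j a_k^j,
-- each g_j is homogeneous of weight ω - κj in the other variables (κ = α + βk), and the same
-- bookkeeping applied to the Sylvester matrix of g and g′, with its first column divided by g_d,
-- shows that disc(g) = DD_{n,k} is homogeneous of weight 2(d-1)ω - d(d-1)κ, where d = n - 1 or n.
module Submission where

open import Defs
open import Data.Nat using (ℕ; zero; suc; _+_; _*_; _∸_; _≤_; _<_; z≤n; s≤s; _<ᵇ_; _≤ᵇ_; _≡ᵇ_)
import Data.Nat as ℕ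
import Data.Nat.Properties as ℕₚ
open import Data.Nat.Tactic.RingSolver using (solve-∀)
open import Data.Integer using (ℤ; +_; -1ℤ; _^_) renaming (_+_ to _+ℤ_; _*_ to _*ℤ_; _≟_ to _≟ℤ_)
import Data.Integer.Properties as ℤₚ
open import Algebra.Properties.CommutativeSemigroup ℤₚ.+-commutativeSemigroup using () renaming (interchange to +ℤ-interchange)
open import Algebra.Properties.CommutativeSemigroup ℕₚ.+-commutativeSemigroup
  using () renaming (interchange to +-interchange; x∙yz≈xz∙y to x+yz≡xz+y)
open import Algebra.Properties.CommutativeSemigroup ℤₚ.*-commutativeSemigroup using () renaming (x∙yz≈y∙xz to x*yz≡y*xz)
open import Data.Fin as Fin using (Fin; zero; suc; toℕ)
import Data.Fin.Properties as Finₚ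
open import Data.Fin.Relation.Unary.Top as Top using (‵fromℕ; ‵inj₁)
open import Data.List as List using (List; []; _∷_; _++_; upTo; concatMap)
open import Data.List.Membership.Propositional using (_∈_)
open import Data.List.Membership.Propositional.Properties using (∈-upTo⁻)
import Data.List.Properties as Listₚ
open import Data.List.Relation.Unary.Any using (here; there)
open import Data.Vec using (Vec; []; _∷_; zipWith; lookup; replicate; updateAt; _[_]≔_)
import Data.Vec.Properties as Vecₚ
open import Data.Vec.Properties using (≡-dec)
open import Data.Product using (∃; ∃₂; _×_; _,_)
open import Data.Sum using (_⊎_; inj₁; inj₂)
open import Data.Empty using (⊥-elim)
open import Data.Bool using (true; false; if_then_else_; _∨_)
import Data.Bool.Properties as Boolₚ
open import Relation.Nullary using (yes; no; does)
open import Relation.Nullary.Reflects using (ofʸ; ofⁿ)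
open import Function using (id; const)
open import Relation.Binary.PropositionalEquality
open ≡-Reasoning
open import Relation.Binary.Bundles using (Setoid)

private variable
  X Y : Set

sumℤ : List X → (X → ℤ) → ℤ
sumℤ xs f = List.foldr _+ℤ_ (+ 0) (List.map f xs)

sumℤ-cong : ∀ (xs : List X) {f g : X → ℤ} → (∀ x → f x ≡ g x) → sumℤ xs f ≡ sumℤ xs g
sumℤ-cong []       f≗g = refl
sumℤ-cong (x ∷ xs) f≗g = cong₂ _+ℤ_ (f≗g x) (sumℤ-cong xs f≗g)

sumℤ-++ : ∀ (xs ys : List X) f → sumℤ (xs ++ ys) f ≡ sumℤ xs f +ℤ sumℤ ys f
sumℤ-++ []       ys f = sym (ℤₚ.+-identityˡ _)
sumℤ-++ (x ∷ xs) ys f = trans (cong (f x +ℤ_) (sumℤ-++ xs ys f)) (sym (ℤₚ.+-assoc (f x) _ _))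

sumℤ-+ : ∀ (xs : List X) f g → sumℤ xs (λ x → f x +ℤ g x) ≡ sumℤ xs f +ℤ sumℤ xs g
sumℤ-+ []       f g = refl
sumℤ-+ (x ∷ xs) f g = trans (cong (f x +ℤ g x +ℤ_) (sumℤ-+ xs f g)) (+ℤ-interchange (f x) (g x) _ _)

sumℤ-*ˡ : ∀ (xs : List X) c f → c *ℤ sumℤ xs f ≡ sumℤ xs (λ x → c *ℤ f x)
sumℤ-*ˡ []       c f = ℤₚ.*-zeroʳ c
sumℤ-*ˡ (x ∷ xs) c f = trans (ℤₚ.*-distribˡ-+ c (f x) _) (cong (c *ℤ f x +ℤ_) (sumℤ-*ˡ xs c f))

sumℤ-*ʳ : ∀ (xs : List X) c f → sumℤ xs f *ℤ c ≡ sumℤ xs (λ x → f x *ℤ c)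
sumℤ-*ʳ xs c f = trans (ℤₚ.*-comm _ c) (trans (sumℤ-*ˡ xs c f) (sumℤ-cong xs (λ x → ℤₚ.*-comm c (f x))))

sumℤ-zero : ∀ (xs : List X) {f} → (∀ x → f x ≡ + 0) → sumℤ xs f ≡ + 0
sumℤ-zero []       f≗0 = refl
sumℤ-zero (x ∷ xs) f≗0 = cong₂ _+ℤ_ (f≗0 x) (sumℤ-zero xs f≗0)

sumℤ-≢0 : ∀ (xs : List X) f → sumℤ xs f ≢ + 0 → ∃ λ x → x ∈ xs × f x ≢ + 0
sumℤ-≢0 []       f sum≢0 = ⊥-elim (sum≢0 refl)
sumℤ-≢0 (x ∷ xs) f sum≢0 with f x ≟ℤ + 0
... | no  fx≢0 = x , here refl , fx≢0
... | yes fx≡0 with sumℤ-≢0 xs f (λ rest≡0 → sum≢0 (cong₂ _+ℤ_ fx≡0 rest≡0))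
...   | y , y∈xs , fy≢0 = y , there y∈xs , fy≢0

sumℤ-map : ∀ (h : Y → X) (ys : List Y) f → sumℤ (List.map h ys) f ≡ sumℤ ys (λ y → f (h y))
sumℤ-map h []       f = refl
sumℤ-map h (y ∷ ys) f = cong (f (h y) +ℤ_) (sumℤ-map h ys f)

sumℤ-concatMap : ∀ (h : Y → List X) (ys : List Y) f →
                 sumℤ (concatMap h ys) f ≡ sumℤ ys (λ y → sumℤ (h y) f)
sumℤ-concatMap h []       f = refl
sumℤ-concatMap h (y ∷ ys) f =
  trans (sumℤ-++ (h y) (concatMap h ys) f) (cong (sumℤ (h y) f +ℤ_) (sumℤ-concatMap h ys f))

sumℤ-comm : ∀ (xs : List X) (ys : List Y) (f : X → Y → ℤ) →
            sumℤ xs (λ x → sumℤ ys (f x)) ≡ sumℤ ys (λ y → sumℤ xs (λ x → f x y))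
sumℤ-comm []       ys f = sym (sumℤ-zero ys (λ _ → refl))
sumℤ-comm (x ∷ xs) ys f =
  trans (cong (sumℤ ys (f x) +ℤ_) (sumℤ-comm xs ys f)) (sym (sumℤ-+ ys (f x) _))

sumℤ-upTo-suc : ∀ n f → sumℤ (upTo (suc n)) f ≡ f 0 +ℤ sumℤ (upTo n) (λ i → f (suc i))
sumℤ-upTo-suc n f =
  cong (f 0 +ℤ_) (trans (cong (λ xs → sumℤ xs f) (sym (Listₚ.map-upTo suc n))) (sumℤ-map suc (upTo n) f))

opaque
  splitSumℕ : ℕ → (ℕ → ℕ → ℤ) → ℤ
  splitSumℕ x g = sumℤ (upTo (suc x)) (λ i → g i (x ∸ i))

  splitSumℕ-zero : ∀ g → splitSumℕ 0 g ≡ g 0 0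
  splitSumℕ-zero g = ℤₚ.+-identityʳ (g 0 0)

  splitSumℕ-suc : ∀ x g → splitSumℕ (suc x) g ≡ g 0 (suc x) +ℤ splitSumℕ x (λ i j → g (suc i) j)
  splitSumℕ-suc x g = sumℤ-upTo-suc (suc x) (λ i → g i (suc x ∸ i))

  splitSumℕ-cong : ∀ x {g h : ℕ → ℕ → ℤ} → (∀ i j → g i j ≡ h i j) → splitSumℕ x g ≡ splitSumℕ x h
  splitSumℕ-cong x g≗h = sumℤ-cong (upTo (suc x)) (λ i → g≗h i (x ∸ i))

  splitSumℕ-+ : ∀ x g h → splitSumℕ x (λ i j → g i j +ℤ h i j) ≡ splitSumℕ x g +ℤ splitSumℕ x h
  splitSumℕ-+ x g h = sumℤ-+ (upTo (suc x)) (λ i → g i (x ∸ i)) (λ i → h i (x ∸ i))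

  splitSumℕ-sumℤ : ∀ x (xs : List X) (f : ℕ → ℕ → X → ℤ) →
                   splitSumℕ x (λ i j → sumℤ xs (f i j)) ≡ sumℤ xs (λ y → splitSumℕ x (λ i j → f i j y))
  splitSumℕ-sumℤ x xs f = sumℤ-comm (upTo (suc x)) xs (λ i → f i (x ∸ i))

  splitSumℕ-zeros : ∀ x {g} → (∀ i j → g i j ≡ + 0) → splitSumℕ x g ≡ + 0
  splitSumℕ-zeros x g≗0 = sumℤ-zero (upTo (suc x)) (λ i → g≗0 i (x ∸ i))

  splitSumℕ-≢0 : ∀ x g → splitSumℕ x g ≢ + 0 → ∃₂ λ i j → x ≡ i + j × g i j ≢ + 0
  splitSumℕ-≢0 x g sum≢0 with sumℤ-≢0 (upTo (suc x)) (λ i → g i (x ∸ i)) sum≢0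
  ... | i , i∈ , g≢0 = i , x ∸ i , sym (ℕₚ.m+[n∸m]≡n (ℕₚ.≤-pred (∈-upTo⁻ i∈))) , g≢0

splitSumℕ-sucʳ : ∀ x g → splitSumℕ (suc x) g ≡ splitSumℕ x (λ i j → g i (suc j)) +ℤ g (suc x) 0
splitSumℕ-sucʳ zero g = begin
  splitSumℕ 1 g                                ≡⟨ splitSumℕ-suc 0 g ⟩
  g 0 1 +ℤ splitSumℕ 0 (λ i j → g (suc i) j)   ≡⟨ cong (g 0 1 +ℤ_) (splitSumℕ-zero (λ i j → g (suc i) j)) ⟩
  g 0 1 +ℤ g 1 0                               ≡⟨ cong (_+ℤ g 1 0) (sym (splitSumℕ-zero (λ i j → g i (suc j)))) ⟩
  splitSumℕ 0 (λ i j → g i (suc j)) +ℤ g 1 0   ∎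
splitSumℕ-sucʳ (suc x) g = begin
  splitSumℕ (suc (suc x)) g
    ≡⟨ splitSumℕ-suc (suc x) g ⟩
  g 0 (suc (suc x)) +ℤ splitSumℕ (suc x) (λ i j → g (suc i) j)
    ≡⟨ cong (g 0 (suc (suc x)) +ℤ_) (splitSumℕ-sucʳ x (λ i j → g (suc i) j)) ⟩
  g 0 (suc (suc x)) +ℤ (splitSumℕ x (λ i j → g (suc i) (suc j)) +ℤ g (suc (suc x)) 0)
    ≡⟨ sym (ℤₚ.+-assoc (g 0 (suc (suc x))) _ _) ⟩
  g 0 (suc (suc x)) +ℤ splitSumℕ x (λ i j → g (suc i) (suc j)) +ℤ g (suc (suc x)) 0
    ≡⟨ cong (_+ℤ g (suc (suc x)) 0) (sym (splitSumℕ-suc x (λ i j → g i (suc j)))) ⟩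
  splitSumℕ (suc x) (λ i j → g i (suc j)) +ℤ g (suc (suc x)) 0
    ∎

splitSumℕ-flip : ∀ x g → splitSumℕ x g ≡ splitSumℕ x (λ i j → g j i)
splitSumℕ-flip zero    g = trans (splitSumℕ-zero g) (sym (splitSumℕ-zero (λ i j → g j i)))
splitSumℕ-flip (suc x) g = begin
  splitSumℕ (suc x) g                                      ≡⟨ splitSumℕ-sucʳ x g ⟩
  splitSumℕ x (λ i j → g i (suc j)) +ℤ g (suc x) 0         ≡⟨ cong (_+ℤ g (suc x) 0) (splitSumℕ-flip x (λ i j → g i (suc j))) ⟩
  splitSumℕ x (λ i j → g j (suc i)) +ℤ g (suc x) 0         ≡⟨ ℤₚ.+-comm _ (g (suc x) 0) ⟩
  g (suc x) 0 +ℤ splitSumℕ x (λ i j → g j (suc i))         ≡⟨ sym (splitSumℕ-suc x (λ i j → g j i)) ⟩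
  splitSumℕ (suc x) (λ i j → g j i)                        ∎

splitSumℕ-assoc : ∀ x (f : ℕ → ℕ → ℕ → ℤ) →
                  splitSumℕ x (λ i u → splitSumℕ i (λ j t → f j t u)) ≡
                  splitSumℕ x (λ j v → splitSumℕ v (λ t u → f j t u))
splitSumℕ-assoc zero    f = begin
  splitSumℕ 0 (λ i u → splitSumℕ i (λ j t → f j t u))  ≡⟨ splitSumℕ-zero (λ i u → splitSumℕ i (λ j t → f j t u)) ⟩
  splitSumℕ 0 (λ j t → f j t 0)                        ≡⟨ splitSumℕ-zero (λ j t → f j t 0) ⟩
  f 0 0 0                                              ≡⟨ sym (splitSumℕ-zero (λ t u → f 0 t u)) ⟩
  splitSumℕ 0 (λ t u → f 0 t u)                        ≡⟨ sym (splitSumℕ-zero (λ j v → splitSumℕ v (λ t u → f j t u))) ⟩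
  splitSumℕ 0 (λ j v → splitSumℕ v (λ t u → f j t u))  ∎
splitSumℕ-assoc (suc x) f = begin
  splitSumℕ (suc x) (λ i u → splitSumℕ i (λ j t → f j t u))
    ≡⟨ splitSumℕ-suc x (λ i u → splitSumℕ i (λ j t → f j t u)) ⟩
  splitSumℕ 0 (λ j t → f j t (suc x)) +ℤ splitSumℕ x (λ i u → splitSumℕ (suc i) (λ j t → f j t u))
    ≡⟨ cong₂ _+ℤ_ (splitSumℕ-zero (λ j t → f j t (suc x)))
                  (splitSumℕ-cong x (λ i u → splitSumℕ-suc i (λ j t → f j t u))) ⟩
  f 0 0 (suc x) +ℤ splitSumℕ x (λ i u → f 0 (suc i) u +ℤ rest i u)
    ≡⟨ cong (f 0 0 (suc x) +ℤ_) (splitSumℕ-+ x (λ i u → f 0 (suc i) u) rest) ⟩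
  f 0 0 (suc x) +ℤ (splitSumℕ x (λ i u → f 0 (suc i) u) +ℤ splitSumℕ x rest)
    ≡⟨ sym (ℤₚ.+-assoc (f 0 0 (suc x)) _ _) ⟩
  f 0 0 (suc x) +ℤ splitSumℕ x (λ i u → f 0 (suc i) u) +ℤ splitSumℕ x rest
    ≡⟨ cong₂ _+ℤ_ (sym (splitSumℕ-suc x (λ t u → f 0 t u))) (splitSumℕ-assoc x (λ j → f (suc j))) ⟩
  splitSumℕ (suc x) (λ t u → f 0 t u) +ℤ splitSumℕ x (λ j v → splitSumℕ v (λ t u → f (suc j) t u))
    ≡⟨ sym (splitSumℕ-suc x (λ j v → splitSumℕ v (λ t u → f j t u))) ⟩
  splitSumℕ (suc x) (λ j v → splitSumℕ v (λ t u → f j t u))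
    ∎
  where
  rest : ℕ → ℕ → ℤ
  rest i u = splitSumℕ i (λ j t → f (suc j) t u)

opaque
  unfolding splitSumℕ

  splitSum : ∀ {m} → Vec ℕ m → (Vec ℕ m → Vec ℕ m → ℤ) → ℤ
  splitSum e G = sumℤ (below e) (λ a → G a (zipWith _∸_ e a))

  *P-splitSum : ∀ {m} (p q : Poly m) e → (p *P q) e ≡ splitSum e (λ a b → p a *ℤ q b)
  *P-splitSum p q e = refl

  splitSum-[] : ∀ G → splitSum [] G ≡ G [] []
  splitSum-[] G = ℤₚ.+-identityʳ (G [] [])

  splitSum-∷ : ∀ {m} x (e : Vec ℕ m) G →
               splitSum (x ∷ e) G ≡ splitSumℕ x (λ i j → splitSum e (λ a b → G (i ∷ a) (j ∷ b)))
  splitSum-∷ {m} x e G = begin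
    sumℤ (concatMap (λ i → List.map (i ∷_) (below e)) (upTo (suc x))) H
      ≡⟨ sumℤ-concatMap (λ i → List.map (i ∷_) (below e)) (upTo (suc x)) H ⟩
    sumℤ (upTo (suc x)) (λ i → sumℤ (List.map (i ∷_) (below e)) H)
      ≡⟨ sumℤ-cong (upTo (suc x)) (λ i → sumℤ-map (i ∷_) (below e) H) ⟩
    sumℤ (upTo (suc x)) (λ i → sumℤ (below e) (λ a → H (i ∷ a)))
      ∎
    where
    H : Vec ℕ (suc m) → ℤ
    H a = G a (zipWith _∸_ (x ∷ e) a)

  splitSum-cong : ∀ {m} (e : Vec ℕ m) {G H} → (∀ a b → G a b ≡ H a b) → splitSum e G ≡ splitSum e H
  splitSum-cong e G≗H = sumℤ-cong (below e) (λ a → G≗H a (zipWith _∸_ e a))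

  splitSum-+ : ∀ {m} (e : Vec ℕ m) G H → splitSum e (λ a b → G a b +ℤ H a b) ≡ splitSum e G +ℤ splitSum e H
  splitSum-+ e G H = sumℤ-+ (below e) (λ a → G a (zipWith _∸_ e a)) (λ a → H a (zipWith _∸_ e a))

  splitSum-*ˡ : ∀ {m} (e : Vec ℕ m) c G → c *ℤ splitSum e G ≡ splitSum e (λ a b → c *ℤ G a b)
  splitSum-*ˡ e c G = sumℤ-*ˡ (below e) c (λ a → G a (zipWith _∸_ e a))

  splitSum-*ʳ : ∀ {m} (e : Vec ℕ m) c G → splitSum e G *ℤ c ≡ splitSum e (λ a b → G a b *ℤ c)
  splitSum-*ʳ e c G = sumℤ-*ʳ (below e) c (λ a → G a (zipWith _∸_ e a))

  splitSum-zero : ∀ {m} (e : Vec ℕ m) {G} → (∀ a b → G a b ≡ + 0) → splitSum e G ≡ + 0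
  splitSum-zero e G≗0 = sumℤ-zero (below e) (λ a → G≗0 a (zipWith _∸_ e a))

  splitSum-splitSumℕ : ∀ {m} (e : Vec ℕ m) x (H : Vec ℕ m → Vec ℕ m → ℕ → ℕ → ℤ) →
    splitSum e (λ a b → splitSumℕ x (H a b)) ≡ splitSumℕ x (λ i j → splitSum e (λ a b → H a b i j))
  splitSum-splitSumℕ e x H = sym (splitSumℕ-sumℤ x (below e) (λ i j a → H a (zipWith _∸_ e a) i j))

splitSum-flip : ∀ {m} (e : Vec ℕ m) G → splitSum e G ≡ splitSum e (λ a b → G b a)
splitSum-flip []      G = trans (splitSum-[] G) (sym (splitSum-[] (λ a b → G b a)))
splitSum-flip (x ∷ e) G = begin
  splitSum (x ∷ e) G
    ≡⟨ splitSum-∷ x e G ⟩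
  splitSumℕ x (λ i j → splitSum e (λ a b → G (i ∷ a) (j ∷ b)))
    ≡⟨ splitSumℕ-cong x (λ i j → splitSum-flip e (λ a b → G (i ∷ a) (j ∷ b))) ⟩
  splitSumℕ x (λ i j → splitSum e (λ a b → G (i ∷ b) (j ∷ a)))
    ≡⟨ splitSumℕ-flip x (λ i j → splitSum e (λ a b → G (i ∷ b) (j ∷ a))) ⟩
  splitSumℕ x (λ i j → splitSum e (λ a b → G (j ∷ b) (i ∷ a)))
    ≡⟨ sym (splitSum-∷ x e (λ a b → G b a)) ⟩
  splitSum (x ∷ e) (λ a b → G b a)
    ∎

splitSum-assoc : ∀ {m} (e : Vec ℕ m) (F : Vec ℕ m → Vec ℕ m → Vec ℕ m → ℤ) →
                 splitSum e (λ a u → splitSum a (λ b t → F b t u)) ≡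
                 splitSum e (λ b v → splitSum v (λ t u → F b t u))
splitSum-assoc [] F = begin
  splitSum [] (λ a u → splitSum a (λ b t → F b t u))  ≡⟨ splitSum-[] (λ a u → splitSum a (λ b t → F b t u)) ⟩
  splitSum [] (λ b t → F b t [])                      ≡⟨ splitSum-[] (λ b t → F b t []) ⟩
  F [] [] []                                          ≡⟨ sym (splitSum-[] (λ t u → F [] t u)) ⟩
  splitSum [] (λ t u → F [] t u)                      ≡⟨ sym (splitSum-[] (λ b v → splitSum v (λ t u → F b t u))) ⟩
  splitSum [] (λ b v → splitSum v (λ t u → F b t u))  ∎
splitSum-assoc {suc m} (x ∷ e) F = begin
  splitSum (x ∷ e) (λ a u → splitSum a (λ b t → F b t u))
    ≡⟨ splitSum-∷ x e (λ a u → splitSum a (λ b t → F b t u)) ⟩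
  splitSumℕ x (λ i j → splitSum e (λ a u → splitSum (i ∷ a) (λ b t → F b t (j ∷ u))))
    ≡⟨ splitSumℕ-cong x (λ i j → splitSum-cong e (λ a u → splitSum-∷ i a (λ b t → F b t (j ∷ u)))) ⟩
  splitSumℕ x (λ i j → splitSum e (λ a u → splitSumℕ i (λ i′ j′ → splitSum a (λ b t → F′ i′ j′ j b t u))))
    ≡⟨ splitSumℕ-cong x (λ i j → splitSum-splitSumℕ e i (λ a u i′ j′ → splitSum a (λ b t → F′ i′ j′ j b t u))) ⟩
  splitSumℕ x (λ i j → splitSumℕ i (λ i′ j′ → splitSum e (λ a u → splitSum a (λ b t → F′ i′ j′ j b t u))))
    ≡⟨ splitSumℕ-cong x (λ i j → splitSumℕ-cong i (λ i′ j′ → splitSum-assoc e (F′ i′ j′ j))) ⟩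
  splitSumℕ x (λ i j → splitSumℕ i (λ i′ j′ → splitSum e (λ b v → splitSum v (F′ i′ j′ j b))))
    ≡⟨ splitSumℕ-assoc x (λ i′ j′ j → splitSum e (λ b v → splitSum v (F′ i′ j′ j b))) ⟩
  splitSumℕ x (λ i′ v → splitSumℕ v (λ j′ j → splitSum e (λ b v′ → splitSum v′ (F′ i′ j′ j b))))
    ≡⟨ splitSumℕ-cong x (λ i′ v → sym (splitSum-splitSumℕ e v (λ b v′ j′ j → splitSum v′ (F′ i′ j′ j b)))) ⟩
  splitSumℕ x (λ i′ v → splitSum e (λ b v′ → splitSumℕ v (λ j′ j → splitSum v′ (F′ i′ j′ j b))))
    ≡⟨ splitSumℕ-cong x (λ i′ v → splitSum-cong e (λ b v′ → sym (splitSum-∷ v v′ (λ t u → F (i′ ∷ b) t u)))) ⟩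
  splitSumℕ x (λ i′ v → splitSum e (λ b v′ → splitSum (v ∷ v′) (λ t u → F (i′ ∷ b) t u)))
    ≡⟨ sym (splitSum-∷ x e (λ b v → splitSum v (λ t u → F b t u))) ⟩
  splitSum (x ∷ e) (λ b v → splitSum v (λ t u → F b t u))
    ∎
  where
  F′ : ℕ → ℕ → ℕ → Vec ℕ m → Vec ℕ m → Vec ℕ m → ℤ
  F′ i′ j′ j b t u = F (i′ ∷ b) (j′ ∷ t) (j ∷ u)

splitSum-≢0 : ∀ {m} (e : Vec ℕ m) G → splitSum e G ≢ + 0 →
              ∃₂ λ a b → e ≡ zipWith _+_ a b × G a b ≢ + 0
splitSum-≢0 []      G sum≢0 = [] , [] , refl , λ G≡0 → sum≢0 (trans (splitSum-[] G) G≡0)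
splitSum-≢0 (x ∷ e) G sum≢0
  with splitSumℕ-≢0 x _ (λ sum≡0 → sum≢0 (trans (splitSum-∷ x e G) sum≡0))
... | i , j , x≡i+j , inner≢0 with splitSum-≢0 e _ inner≢0
...   | a , b , e≡a+b , G≢0 = i ∷ a , j ∷ b , cong₂ _∷_ x≡i+j e≡a+b , G≢0

splitSum-1Pˡ : ∀ {m} (e : Vec ℕ m) (p : Poly m) → splitSum e (λ a b → 1P a *ℤ p b) ≡ p e
splitSum-1Pˡ []      p = trans (splitSum-[] (λ a b → 1P a *ℤ p b)) (ℤₚ.*-identityˡ (p []))
splitSum-1Pˡ (x ∷ e) p = trans (splitSum-∷ x e (λ a b → 1P a *ℤ p b)) (head x)
  where
  head : ∀ x → splitSumℕ x (λ i j → splitSum e (λ a b → 1P (i ∷ a) *ℤ p (j ∷ b))) ≡ p (x ∷ e)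
  head zero    = trans (splitSumℕ-zero _) (splitSum-1Pˡ e (λ b → p (0 ∷ b)))
  head (suc y) = begin
    splitSumℕ (suc y) (λ i j → splitSum e (λ a b → 1P (i ∷ a) *ℤ p (j ∷ b)))
      ≡⟨ splitSumℕ-suc y _ ⟩
    splitSum e (λ a b → 1P a *ℤ p (suc y ∷ b)) +ℤ splitSumℕ y (λ i j → splitSum e (λ a b → + 0))
      ≡⟨ cong₂ _+ℤ_ (splitSum-1Pˡ e (λ b → p (suc y ∷ b))) (splitSumℕ-cong y (λ i j → splitSum-zero e (λ a b → refl))) ⟩
    p (suc y ∷ e) +ℤ splitSumℕ y (λ i j → + 0)
      ≡⟨ cong (p (suc y ∷ e) +ℤ_) (splitSumℕ-zeros y (λ i j → refl)) ⟩
    p (suc y ∷ e) +ℤ + 0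
      ≡⟨ ℤₚ.+-identityʳ _ ⟩
    p (suc y ∷ e)
      ∎

module ≈P {m} = Setoid (Vec ℕ m →-setoid ℤ)

+P-cong : ∀ {m} {p p′ q q′ : Poly m} → p ≈P p′ → q ≈P q′ → (p +P q) ≈P (p′ +P q′)
+P-cong p≈p′ q≈q′ e = cong₂ _+ℤ_ (p≈p′ e) (q≈q′ e)

·P-cong : ∀ {m} c {p p′ : Poly m} → p ≈P p′ → (c ·P p) ≈P (c ·P p′)
·P-cong c p≈p′ e = cong (c *ℤ_) (p≈p′ e)

*P-cong : ∀ {m} {p p′ q q′ : Poly m} → p ≈P p′ → q ≈P q′ → (p *P q) ≈P (p′ *P q′)
*P-cong {p = p} {p′} {q} {q′} p≈p′ q≈q′ e = begin
  (p *P q) e                                ≡⟨ *P-splitSum p q e ⟩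
  splitSum e (λ a b → p a *ℤ q b)           ≡⟨ splitSum-cong e (λ a b → cong₂ _*ℤ_ (p≈p′ a) (q≈q′ b)) ⟩
  splitSum e (λ a b → p′ a *ℤ q′ b)         ≡⟨ sym (*P-splitSum p′ q′ e) ⟩
  (p′ *P q′) e                              ∎

*P-comm : ∀ {m} (p q : Poly m) → (p *P q) ≈P (q *P p)
*P-comm p q e = begin
  (p *P q) e                                ≡⟨ *P-splitSum p q e ⟩
  splitSum e (λ a b → p a *ℤ q b)           ≡⟨ splitSum-flip e (λ a b → p a *ℤ q b) ⟩
  splitSum e (λ a b → p b *ℤ q a)           ≡⟨ splitSum-cong e (λ a b → ℤₚ.*-comm (p b) (q a)) ⟩
  splitSum e (λ a b → q a *ℤ p b)           ≡⟨ sym (*P-splitSum q p e) ⟩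
  (q *P p) e                                ∎

*P-assoc : ∀ {m} (p q r : Poly m) → ((p *P q) *P r) ≈P (p *P (q *P r))
*P-assoc p q r e = begin
  ((p *P q) *P r) e
    ≡⟨ *P-splitSum (p *P q) r e ⟩
  splitSum e (λ a u → (p *P q) a *ℤ r u)
    ≡⟨ splitSum-cong e (λ a u → cong (_*ℤ r u) (*P-splitSum p q a)) ⟩
  splitSum e (λ a u → splitSum a (λ b t → p b *ℤ q t) *ℤ r u)
    ≡⟨ splitSum-cong e (λ a u → splitSum-*ʳ a (r u) (λ b t → p b *ℤ q t)) ⟩
  splitSum e (λ a u → splitSum a (λ b t → p b *ℤ q t *ℤ r u))
    ≡⟨ splitSum-assoc e (λ b t u → p b *ℤ q t *ℤ r u) ⟩
  splitSum e (λ b v → splitSum v (λ t u → p b *ℤ q t *ℤ r u))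
    ≡⟨ splitSum-cong e (λ b v → splitSum-cong v (λ t u → ℤₚ.*-assoc (p b) (q t) (r u))) ⟩
  splitSum e (λ b v → splitSum v (λ t u → p b *ℤ (q t *ℤ r u)))
    ≡⟨ splitSum-cong e (λ b v → sym (splitSum-*ˡ v (p b) (λ t u → q t *ℤ r u))) ⟩
  splitSum e (λ b v → p b *ℤ splitSum v (λ t u → q t *ℤ r u))
    ≡⟨ splitSum-cong e (λ b v → cong (p b *ℤ_) (sym (*P-splitSum q r v))) ⟩
  splitSum e (λ b v → p b *ℤ (q *P r) v)
    ≡⟨ sym (*P-splitSum p (q *P r) e) ⟩
  (p *P (q *P r)) e
    ∎

*P-distribˡ-+P : ∀ {m} (p q r : Poly m) → (p *P (q +P r)) ≈P (p *P q +P p *P r)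
*P-distribˡ-+P p q r e = begin
  (p *P (q +P r)) e
    ≡⟨ *P-splitSum p (q +P r) e ⟩
  splitSum e (λ a b → p a *ℤ (q b +ℤ r b))
    ≡⟨ splitSum-cong e (λ a b → ℤₚ.*-distribˡ-+ (p a) (q b) (r b)) ⟩
  splitSum e (λ a b → p a *ℤ q b +ℤ p a *ℤ r b)
    ≡⟨ splitSum-+ e (λ a b → p a *ℤ q b) (λ a b → p a *ℤ r b) ⟩
  splitSum e (λ a b → p a *ℤ q b) +ℤ splitSum e (λ a b → p a *ℤ r b)
    ≡⟨ sym (cong₂ _+ℤ_ (*P-splitSum p q e) (*P-splitSum p r e)) ⟩
  (p *P q +P p *P r) e
    ∎

*P-zeroʳ : ∀ {m} (p : Poly m) → (p *P 0P) ≈P 0P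
*P-zeroʳ p e = trans (*P-splitSum p 0P e) (splitSum-zero e (λ a b → ℤₚ.*-zeroʳ (p a)))

*P-identityˡ : ∀ {m} (p : Poly m) → (1P *P p) ≈P p
*P-identityˡ p e = trans (*P-splitSum 1P p e) (splitSum-1Pˡ e p)

*P-identityʳ : ∀ {m} (p : Poly m) → (p *P 1P) ≈P p
*P-identityʳ p = ≈P.trans (*P-comm p 1P) (*P-identityˡ p)

·P-*P : ∀ {m} c (p q : Poly m) → (c ·P (p *P q)) ≈P (p *P (c ·P q))
·P-*P c p q e = begin
  c *ℤ (p *P q) e                           ≡⟨ cong (c *ℤ_) (*P-splitSum p q e) ⟩
  c *ℤ splitSum e (λ a b → p a *ℤ q b)      ≡⟨ splitSum-*ˡ e c (λ a b → p a *ℤ q b) ⟩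
  splitSum e (λ a b → c *ℤ (p a *ℤ q b))    ≡⟨ splitSum-cong e (λ a b → x*yz≡y*xz c (p a) (q b)) ⟩
  splitSum e (λ a b → p a *ℤ (c *ℤ q b))    ≡⟨ sym (*P-splitSum p (c ·P q) e) ⟩
  (p *P (c ·P q)) e                         ∎

·P-*P-1P : ∀ {m} k (p : Poly m) → ((+ k) ·P p) ≈P (p *P ((+ k) ·P 1P))
·P-*P-1P k p = ≈P.trans (·P-cong (+ k) (≈P.sym (*P-identityʳ p))) (·P-*P (+ k) p 1P)

*P-≢0 : ∀ {m} (p q : Poly m) e → (p *P q) e ≢ + 0 →
        ∃₂ λ a b → e ≡ zipWith _+_ a b × p a ≢ + 0 × q b ≢ + 0
*P-≢0 p q e pq≢0 with splitSum-≢0 e (λ a b → p a *ℤ q b) (λ sum≡0 → pq≢0 (trans (*P-splitSum p q e) sum≡0))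
... | a , b , e≡a+b , pq≢0′ =
  a , b , e≡a+b , (λ p≡0 → pq≢0′ (cong (_*ℤ q b) p≡0))
                , (λ q≡0 → pq≢0′ (trans (cong (p a *ℤ_) q≡0) (ℤₚ.*-zeroʳ (p a))))

·P-≢0 : ∀ {m} c (p : Poly m) e → (c ·P p) e ≢ + 0 → p e ≢ + 0
·P-≢0 c p e cp≢0 p≡0 = cp≢0 (trans (cong (c *ℤ_) p≡0) (ℤₚ.*-zeroʳ c))

1P-≢0 : ∀ {m} (e : Vec ℕ m) → 1P e ≢ + 0 → isZeroVec e ≡ true
1P-≢0 e 1P≢0 with isZeroVec e
... | true  = refl
... | false = ⊥-elim (1P≢0 refl)

sumP-apply : ∀ {m} (xs : List ℕ) (t : ℕ → Poly m) e → sumP (List.map t xs) e ≡ sumℤ xs (λ j → t j e)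
sumP-apply []       t e = refl
sumP-apply (x ∷ xs) t e = cong (t x e +ℤ_) (sumP-apply xs t e)

sumP-cong : ∀ {m} (xs : List ℕ) {t u : ℕ → Poly m} → (∀ j → j ∈ xs → t j ≈P u j) →
            sumP (List.map t xs) ≈P sumP (List.map u xs)
sumP-cong []       t≈u = ≈P.refl
sumP-cong (x ∷ xs) t≈u = +P-cong (t≈u x (here refl)) (sumP-cong xs (λ j j∈xs → t≈u j (there j∈xs)))

*P-distribˡ-sumP : ∀ {m} (s : Poly m) (xs : List ℕ) (t : ℕ → Poly m) →
                   (s *P sumP (List.map t xs)) ≈P sumP (List.map (λ j → s *P t j) xs)
*P-distribˡ-sumP s []       t = *P-zeroʳ s
*P-distribˡ-sumP s (x ∷ xs) t =
  ≈P.trans (*P-distribˡ-+P s (t x) (sumP (List.map t xs))) (+P-cong {p = s *P t x} ≈P.refl (*P-distribˡ-sumP s xs t))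

laplaceTerm : ∀ {m} → ℕ → (ℕ → ℕ → Poly m) → ℕ → Poly m
laplaceTerm N M j = (-1ℤ ^ j) ·P (M 0 j *P det N (minor M j))

det-cong : ∀ {m} N {M M′ : ℕ → ℕ → Poly m} → (∀ r c → M r c ≈P M′ r c) → det N M ≈P det N M′
det-cong zero    M≈M′ = ≈P.refl
det-cong (suc N) {M} {M′} M≈M′ = sumP-cong (upTo (suc N)) (λ j _ →
  ·P-cong (-1ℤ ^ j) (*P-cong (M≈M′ 0 j) (det-cong N {minor M j} {minor M′ j} (λ r c → M≈M′ (suc r) _))))

·P-pull-*Pˡ : ∀ {m} c (s a d : Poly m) → (c ·P ((s *P a) *P d)) ≈P (s *P (c ·P (a *P d)))
·P-pull-*Pˡ c s a d = ≈P.trans (·P-cong c (*P-assoc s a d)) (·P-*P c s (a *P d))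

·P-pull-*Pʳ : ∀ {m} c (s a d : Poly m) → (c ·P (a *P (s *P d))) ≈P (s *P (c ·P (a *P d)))
·P-pull-*Pʳ c s a d =
  ≈P.trans (·P-cong c (≈P.trans (≈P.sym (*P-assoc a s d)) (*P-cong {q = d} (*P-comm a s) ≈P.refl))) (·P-pull-*Pˡ c s a d)

det-scaleCol0 : ∀ {m} N (s : Poly m) {M M′ : ℕ → ℕ → Poly m} →
                (∀ r → M r 0 ≈P (s *P M′ r 0)) → (∀ r c → M r (suc c) ≈P M′ r (suc c)) →
                det (suc N) M ≈P (s *P det (suc N) M′)
det-scaleCol0 N s {M} {M′} col0 cols =
  ≈P.trans (sumP-cong (upTo (suc N)) (λ j j∈ → term j (∈-upTo⁻ j∈)))
           (≈P.sym (*P-distribˡ-sumP s (upTo (suc N)) (laplaceTerm N M′)))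
  where
  minor-scale : ∀ {N} j → j < N → det N (minor M (suc j)) ≈P (s *P det N (minor M′ (suc j)))
  minor-scale {suc N′} j _ = det-scaleCol0 N′ s {minor M (suc j)} {minor M′ (suc j)} (λ r → col0 (suc r)) minor-cols
    where
    minor-cols : ∀ r c → minor M (suc j) r (suc c) ≈P minor M′ (suc j) r (suc c)
    minor-cols r c with c <ᵇ j
    ... | true  = cols (suc r) c
    ... | false = cols (suc r) (suc c)

  term : ∀ j → j < suc N → laplaceTerm N M j ≈P (s *P laplaceTerm N M′ j)
  term zero    _         = ≈P.trans (·P-cong (+ 1) (*P-cong (col0 0) (det-cong N {minor M 0} {minor M′ 0} (λ r c → cols (suc r) c))))
                                    (·P-pull-*Pˡ (+ 1) s (M′ 0 0) (det N (minor M′ 0)))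
  term (suc j) (s≤s j<N) = ≈P.trans (·P-cong (-1ℤ ^ suc j) (*P-cong (cols 0 j) (minor-scale j j<N)))
                                    (·P-pull-*Pʳ (-1ℤ ^ suc j) s (M′ 0 (suc j)) (det N (minor M′ (suc j))))

AllMonomials : ∀ {m} → (Vec ℕ m → Set) → Poly m → Set
AllMonomials P p = ∀ e → p e ≢ + 0 → P e

weight : ∀ {m} → (Fin m → ℕ) → Vec ℕ m → ℕ
weight c []      = 0
weight c (x ∷ e) = c zero * x + weight (λ i → c (suc i)) e

zeroAt : ∀ {m} → Fin m → (Fin m → ℕ) → Fin m → ℕ
zeroAt k c i = if does (i Fin.≟ k) then 0 else c i

weight-+ : ∀ {m} (c : Fin m → ℕ) a b → weight c (zipWith _+_ a b) ≡ weight c a + weight c b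
weight-+ c []      []      = refl
weight-+ {suc m} c (x ∷ a) (y ∷ b) = begin
  c zero * (x + y) + weight c′ (zipWith _+_ a b)
    ≡⟨ cong₂ _+_ (ℕₚ.*-distribˡ-+ (c zero) x y) (weight-+ c′ a b) ⟩
  (c zero * x + c zero * y) + (weight c′ a + weight c′ b)
    ≡⟨ +-interchange (c zero * x) (c zero * y) (weight c′ a) (weight c′ b) ⟩
  (c zero * x + weight c′ a) + (c zero * y + weight c′ b)
    ∎
  where
  c′ : Fin m → ℕ
  c′ i = c (suc i)

weight-zero : ∀ {m} (c : Fin m → ℕ) e → isZeroVec e ≡ true → weight c e ≡ 0
weight-zero c []           _     = refl
weight-zero c (zero ∷ e)   e≡0   = trans (cong (_+ weight (λ i → c (suc i)) e) (ℕₚ.*-zeroʳ (c zero)))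
                                         (weight-zero (λ i → c (suc i)) e e≡0)

weight-updateAt : ∀ {m} (c : Fin m → ℕ) k f e →
                  weight c (updateAt e k f) ≡ weight (zeroAt k c) e + c k * f (lookup e k)
weight-updateAt c zero    f (x ∷ e) = ℕₚ.+-comm (c zero * f x) _
weight-updateAt c (suc k) f (x ∷ e) =
  trans (cong (λ w → c zero * x + w) (weight-updateAt (λ i → c (suc i)) k f e)) (sym (ℕₚ.+-assoc (c zero * x) _ _))

weight-lookup : ∀ {m} (c : Fin m → ℕ) k e → weight c e ≡ weight (zeroAt k c) e + c k * lookup e k
weight-lookup c k e = trans (cong (weight c) (sym (Vecₚ.updateAt-id k e))) (weight-updateAt c k id e)

weight-updateAt-suc : ∀ {m} (c : Fin m → ℕ) k e → weight c (updateAt e k suc) ≡ weight c e + c k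
weight-updateAt-suc c k e = begin
  weight c (updateAt e k suc)                         ≡⟨ weight-updateAt c k suc e ⟩
  weight (zeroAt k c) e + c k * suc (lookup e k)      ≡⟨ cong (λ w → weight (zeroAt k c) e + w) (ℕₚ.*-suc (c k) (lookup e k)) ⟩
  weight (zeroAt k c) e + (c k + c k * lookup e k)    ≡⟨ x+yz≡xz+y (weight (zeroAt k c) e) (c k) (c k * lookup e k) ⟩
  weight (zeroAt k c) e + c k * lookup e k + c k      ≡⟨ cong (_+ c k) (sym (weight-lookup c k e)) ⟩
  weight c e + c k                                    ∎

weight-unit : ∀ {m} (c : Fin m → ℕ) i → weight c (replicate m 0 [ i ]≔ 1) ≡ c i
weight-unit {m} c i = begin
  weight c (replicate m 0 [ i ]≔ 1)               ≡⟨ weight-updateAt c i (const 1) (replicate m 0) ⟩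
  weight (zeroAt i c) (replicate m 0) + c i * 1
    ≡⟨ cong₂ _+_ (weight-zero (zeroAt i c) (replicate m 0) (isZeroVec-replicate m)) (ℕₚ.*-identityʳ (c i)) ⟩
  c i                                             ∎
  where
  isZeroVec-replicate : ∀ m → isZeroVec (replicate m 0) ≡ true
  isZeroVec-replicate zero    = refl
  isZeroVec-replicate (suc m) = isZeroVec-replicate m

sumFin-cong : ∀ {N} {f g : Fin N → ℕ} → (∀ i → f i ≡ g i) → sumFin f ≡ sumFin g
sumFin-cong {N} f≗g = cong (List.foldr _+_ 0) (Listₚ.map-cong f≗g (List.allFin N))

sumFin-suc : ∀ {N} (f : Fin (suc N) → ℕ) → sumFin f ≡ f zero + sumFin (λ i → f (suc i))
sumFin-suc {N} f = cong (λ xs → f zero + List.foldr _+_ 0 xs) (begin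
  List.map f (List.tabulate suc)                 ≡⟨ Listₚ.map-tabulate suc f ⟩
  List.tabulate (λ i → f (suc i))                ≡⟨ sym (Listₚ.map-tabulate id (λ i → f (suc i))) ⟩
  List.map (λ i → f (suc i)) (List.allFin N)     ∎)

sumFin-weight : ∀ {m} (c : Fin m → ℕ) e → sumFin (λ i → c i * lookup e i) ≡ weight c e
sumFin-weight c []      = refl
sumFin-weight c (x ∷ e) =
  trans (sumFin-suc (λ i → c i * lookup (x ∷ e) i)) (cong (λ w → c zero * x + w) (sumFin-weight (λ i → c (suc i)) e))

degOff-weight : ∀ {n} (k : Fin (suc n)) e → degOff k e ≡ weight (zeroAt k (λ _ → 1)) e
degOff-weight k e = trans (sumFin-cong pointwise) (sumFin-weight (zeroAt k (λ _ → 1)) e)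
  where
  pointwise : ∀ i → (if does (i Fin.≟ k) then 0 else lookup e i) ≡ zeroAt k (λ _ → 1) i * lookup e i
  pointwise i with does (i Fin.≟ k)
  ... | true  = refl
  ... | false = sym (ℕₚ.*-identityˡ (lookup e i))

weightOff-weight : ∀ {n} (k : Fin (suc n)) e → weightOff k e ≡ weight (zeroAt k toℕ) e
weightOff-weight k e = trans (sumFin-cong pointwise) (sumFin-weight (zeroAt k toℕ) e)
  where
  pointwise : ∀ i → (if does (i Fin.≟ k) then 0 else toℕ i * lookup e i) ≡ zeroAt k toℕ i * lookup e i
  pointwise i with does (i Fin.≟ k)
  ... | true  = refl
  ... | false = refl

sumTo : ℕ → (ℕ → ℕ) → ℕ
sumTo zero    f = 0
sumTo (suc N) f = f 0 + sumTo N (λ i → f (suc i))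

sumTo-cong : ∀ N {f g : ℕ → ℕ} → (∀ i → f i ≡ g i) → sumTo N f ≡ sumTo N g
sumTo-cong zero    f≗g = refl
sumTo-cong (suc N) f≗g = cong₂ _+_ (f≗g 0) (sumTo-cong N (λ i → f≗g (suc i)))

sumTo-+ : ∀ N (f g : ℕ → ℕ) → sumTo N (λ i → f i + g i) ≡ sumTo N f + sumTo N g
sumTo-+ zero    f g = refl
sumTo-+ (suc N) f g =
  trans (cong (λ s → f 0 + g 0 + s) (sumTo-+ N (λ i → f (suc i)) (λ i → g (suc i)))) (+-interchange (f 0) (g 0) _ _)

sumTo-const : ∀ N x → sumTo N (λ _ → x) ≡ N * x
sumTo-const zero    x = refl
sumTo-const (suc N) x = cong (λ s → x + s) (sumTo-const N x)

-- minor M j r c is definitionally M (suc r) (punchInℕ j c).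
punchInℕ : ℕ → ℕ → ℕ
punchInℕ j c = if c <ᵇ j then c else suc c

sumTo-punchIn : ∀ N j (f : ℕ → ℕ) → j < suc N → sumTo N (λ c → f (punchInℕ j c)) + f j ≡ sumTo (suc N) f
sumTo-punchIn N       zero    f _         = ℕₚ.+-comm (sumTo N (λ c → f (suc c))) (f 0)
sumTo-punchIn (suc N) (suc j) f (s≤s j<N) = begin
  f 0 + sumTo N (λ c → f (punchInℕ (suc j) (suc c))) + f (suc j)
    ≡⟨ ℕₚ.+-assoc (f 0) _ _ ⟩
  f 0 + (sumTo N (λ c → f (punchInℕ (suc j) (suc c))) + f (suc j))
    ≡⟨ cong (λ s → f 0 + (s + f (suc j))) (sumTo-cong N (λ c → cong f (punchInℕ-suc j c))) ⟩
  f 0 + (sumTo N (λ c → f (suc (punchInℕ j c))) + f (suc j))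
    ≡⟨ cong (λ s → f 0 + s) (sumTo-punchIn N j (λ c → f (suc c)) j<N) ⟩
  f 0 + sumTo (suc N) (λ c → f (suc c))
    ∎
  where
  punchInℕ-suc : ∀ j c → punchInℕ (suc j) (suc c) ≡ suc (punchInℕ j c)
  punchInℕ-suc j c with c <ᵇ j
  ... | true  = refl
  ... | false = refl

punchInℕ-< : ∀ N j c → c < N → punchInℕ j c < suc N
punchInℕ-< N j c c<N with c <ᵇ j
... | true  = ℕₚ.m≤n⇒m≤1+n c<N
... | false = s≤s c<N

det-weight : ∀ {m} (c : Fin m → ℕ) N (M : ℕ → ℕ → Poly m) (A B C E : ℕ → ℕ) →
  (∀ r s → r < N → s < N → AllMonomials (λ v → weight c v + A r + B s ≡ C r + E s) (M r s)) →
  AllMonomials (λ v → weight c v + sumTo N A + sumTo N B ≡ sumTo N C + sumTo N E) (det N M)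
det-weight c zero    M A B C E entries v det≢0 = cong (λ w → w + 0 + 0) (weight-zero c v (1P-≢0 v det≢0))
det-weight c (suc N) M A B C E entries v det≢0
  with sumℤ-≢0 (upTo (suc N)) (λ j → laplaceTerm N M j v)
                (λ sum≡0 → det≢0 (trans (sumP-apply (upTo (suc N)) (laplaceTerm N M) v) sum≡0))
... | j , j∈ , term≢0
  with *P-≢0 (M 0 j) (det N (minor M j)) v (·P-≢0 (-1ℤ ^ j) (M 0 j *P det N (minor M j)) v term≢0)
... | a , b , refl , Ma≢0 , minor≢0 = begin
  weight c (zipWith _+_ a b) + sumTo (suc N) A + sumTo (suc N) B
    ≡⟨ cong₂ (λ w s → w + sumTo (suc N) A + s) (weight-+ c a b) (sym (sumTo-punchIn N j B j<)) ⟩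
  (weight c a + weight c b) + (A 0 + sumTo N A′) + (sumTo N B′ + B j)
    ≡⟨ regroup (weight c a) (weight c b) (A 0) (sumTo N A′) (sumTo N B′) (B j) ⟩
  (weight c a + A 0 + B j) + (weight c b + sumTo N A′ + sumTo N B′)
    ≡⟨ cong₂ _+_ (entries 0 j (s≤s z≤n) j< a Ma≢0) (det-weight c N (minor M j) A′ B′ C′ E′ minor-entries b minor≢0) ⟩
  (C 0 + E j) + (sumTo N C′ + sumTo N E′)
    ≡⟨ +-interchange (C 0) (E j) (sumTo N C′) (sumTo N E′) ⟩
  (C 0 + sumTo N C′) + (E j + sumTo N E′)
    ≡⟨ cong (λ s → C 0 + sumTo N C′ + s) (trans (ℕₚ.+-comm (E j) (sumTo N E′)) (sumTo-punchIn N j E j<)) ⟩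
  sumTo (suc N) C + sumTo (suc N) E
    ∎
  where
  j< : j < suc N
  j< = ∈-upTo⁻ j∈
  A′ B′ C′ E′ : ℕ → ℕ
  A′ r = A (suc r)
  B′ s = B (punchInℕ j s)
  C′ r = C (suc r)
  E′ s = E (punchInℕ j s)
  minor-entries : ∀ r s → r < N → s < N →
                  AllMonomials (λ v → weight c v + A′ r + B′ s ≡ C′ r + E′ s) (minor M j r s)
  minor-entries r s r<N s<N = entries (suc r) (punchInℕ j s) (s≤s r<N) (punchInℕ-< N j s s<N)
  regroup : ∀ wa wb a as bs b → (wa + wb) + (a + as) + (bs + b) ≡ (wa + a + b) + (wb + as + bs)
  regroup = solve-∀

∸-+-cancel : ∀ {t d} → t ≤ d → ∀ r → d ∸ t + (t + r) ≡ d + r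
∸-+-cancel {t} {d} t≤d r = trans (sym (ℕₚ.+-assoc (d ∸ t) t r)) (cong (_+ r) (ℕₚ.m∸n+n≡m t≤d))

sylvester-≢0 : ∀ {m} d (g : ℕ → Poly m) e (h : ℕ → Poly m) r s v → sylvester d g e h r s v ≢ + 0 →
  (r < e × ∃ λ j → j ≤ d × j + s ≡ d + r × g j v ≢ + 0) ⊎
  (e ≤ r × ∃ λ j → j ≤ e × j + s ≡ r × h j v ≢ + 0)
sylvester-≢0 d g e h r s v entry≢0 with r <ᵇ e | ℕₚ.<ᵇ-reflects-< r e
... | true  | ofʸ r<e with r ≤ᵇ s | ℕₚ.≤ᵇ-reflects-≤ r s | s ∸ r ≤ᵇ d | ℕₚ.≤ᵇ-reflects-≤ (s ∸ r) d
...   | true  | ofʸ r≤s | true  | ofʸ t≤d = inj₁ (r<e , d ∸ (s ∸ r) , ℕₚ.m∸n≤m d (s ∸ r) , index , entry≢0)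
  where
  index : d ∸ (s ∸ r) + s ≡ d + r
  index = trans (cong (λ x → d ∸ (s ∸ r) + x) (sym (ℕₚ.m∸n+n≡m r≤s))) (∸-+-cancel t≤d r)
...   | true  | _       | false | _      = ⊥-elim (entry≢0 refl)
...   | false | _       | _     | _      = ⊥-elim (entry≢0 refl)
sylvester-≢0 d g e h r s v entry≢0 | false | ofⁿ r≮e
  with r ∸ e ≤ᵇ s | ℕₚ.≤ᵇ-reflects-≤ (r ∸ e) s | s ∸ (r ∸ e) ≤ᵇ e | ℕₚ.≤ᵇ-reflects-≤ (s ∸ (r ∸ e)) e
... | true  | ofʸ r′≤s | true  | ofʸ t≤e = inj₂ (e≤r , e ∸ (s ∸ (r ∸ e)) , ℕₚ.m∸n≤m e (s ∸ (r ∸ e)) , index , entry≢0)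
  where
  e≤r : e ≤ r
  e≤r = ℕₚ.≮⇒≥ r≮e
  index : e ∸ (s ∸ (r ∸ e)) + s ≡ r
  index = begin
    e ∸ (s ∸ (r ∸ e)) + s                      ≡⟨ cong (λ x → e ∸ (s ∸ (r ∸ e)) + x) (sym (ℕₚ.m∸n+n≡m r′≤s)) ⟩
    e ∸ (s ∸ (r ∸ e)) + (s ∸ (r ∸ e) + (r ∸ e)) ≡⟨ ∸-+-cancel t≤e (r ∸ e) ⟩
    e + (r ∸ e)                                ≡⟨ ℕₚ.m+[n∸m]≡n e≤r ⟩
    r                                          ∎
... | true  | _        | false | _      = ⊥-elim (entry≢0 refl)
... | false | _        | _     | _      = ⊥-elim (entry≢0 refl)

-- The first column of the Sylvester matrix of g and g′ is g_d·(1, 0, …, 0, d, 0, …, 0)ᵀ, so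
-- dividing it by g_d divides the resultant exactly.
sylvesterQuot : ∀ {m} → ℕ → (ℕ → Poly m) → ℕ → ℕ → Poly m
sylvesterQuot e g r zero    = sylvester (suc e) (λ _ → 1P) e (deriv (λ _ → 1P)) r 0
sylvesterQuot e g r (suc s) = sylvester (suc e) g e (deriv g) r (suc s)

discQuot : ∀ {m} → ℕ → (ℕ → Poly m) → Poly m
discQuot e g = discSign (suc e) ·P det (e + suc e) (sylvesterQuot e g)

sylvester-col0 : ∀ {m} e (g : ℕ → Poly m) r →
  sylvester (suc e) g e (deriv g) r 0 ≈P (g (suc e) *P sylvesterQuot e g r 0)
sylvester-col0 zero    g zero    = ·P-*P-1P 1 (g 1)
sylvester-col0 (suc e) g zero    = ≈P.sym (*P-identityʳ (g (suc (suc e))))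
sylvester-col0 e       g (suc r) with suc r <ᵇ e | suc r ∸ e
... | true  | _      = ≈P.sym (*P-zeroʳ (g (suc e)))
... | false | zero   = ·P-*P-1P (suc e) (g (suc e))
... | false | suc _  = ≈P.sym (*P-zeroʳ (g (suc e)))

discQuot-isDisc : ∀ {m} e (g : ℕ → Poly m) → IsDisc (suc e) g (discQuot e g)
discQuot-isDisc e g = ≈P.trans (≈P.sym (·P-*P (discSign (suc e)) (g (suc e)) (det N (sylvesterQuot e g))))
                               (·P-cong (discSign (suc e)) (≈P.sym res≈))
  where
  N : ℕ
  N = e + suc e
  res≈ : det N (sylvester (suc e) g e (deriv g)) ≈P (g (suc e) *P det N (sylvesterQuot e g))
  res≈ rewrite ℕₚ.+-suc e e =
    det-scaleCol0 (e + e) (g (suc e)) {sylvester (suc e) g e (deriv g)} {sylvesterQuot e g}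
                  (sylvester-col0 e g) (λ r s → ≈P.refl)

rowOffset : ℕ → ℕ → ℕ → ℕ
rowOffset e x r = if r <ᵇ e then 0 else x

rowOffset-< : ∀ {e r} x → r < e → rowOffset e x r ≡ 0
rowOffset-< {e} {r} x r<e with r <ᵇ e | ℕₚ.<ᵇ-reflects-< r e
... | true  | _        = refl
... | false | ofⁿ r≮e = ⊥-elim (r≮e r<e)

rowOffset-≥ : ∀ {e r} x → e ≤ r → rowOffset e x r ≡ x
rowOffset-≥ {e} {r} x e≤r with r <ᵇ e | ℕₚ.<ᵇ-reflects-< r e
... | true  | ofʸ r<e = ⊥-elim (ℕₚ.<⇒≱ r<e e≤r)
... | false | _       = refl

sumTo-rowOffset : ∀ e b x → sumTo (e + b) (rowOffset e x) ≡ b * x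
sumTo-rowOffset zero    b x = sumTo-const b x
sumTo-rowOffset (suc e) b x = sumTo-rowOffset e b x

sylvesterQuot-col0-≢0 : ∀ {m} e (g : ℕ → Poly m) r v → sylvesterQuot e g r 0 v ≢ + 0 →
                        isZeroVec v ≡ true × (r ≡ 0 × 0 < e ⊎ r ≡ e)
sylvesterQuot-col0-≢0 e g r v entry≢0 with sylvester-≢0 (suc e) (λ _ → 1P) e (deriv (λ _ → 1P)) r 0 v entry≢0
... | inj₁ (r<e , j , j≤d , j≡d+r , 1P≢0) = 1P-≢0 v 1P≢0 , inj₁ (r≡0 , subst (_< e) r≡0 r<e)
  where
  r≡0 : r ≡ 0
  r≡0 = ℕₚ.n≤0⇒n≡0 (ℕₚ.+-cancelˡ-≤ (suc e) r 0 (subst (_≤ suc e + 0) j≡d+r (ℕₚ.+-monoˡ-≤ 0 j≤d)))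
... | inj₂ (e≤r , j , j≤e , j≡r , c1P≢0) = 1P-≢0 v (·P-≢0 (+ suc j) 1P v c1P≢0) , inj₂ r≡e
  where
  r≡e : r ≡ e
  r≡e = ℕₚ.≤-antisym (subst (_≤ e) (trans (sym (ℕₚ.+-identityʳ j)) j≡r) j≤e) e≤r

discQuot-weight : ∀ {m} (c : Fin m → ℕ) κ ω (g : ℕ → Poly m) →
  (∀ j → AllMonomials (λ v → weight c v + κ * j ≡ ω) (g j)) →
  ∀ e → AllMonomials (λ v → weight c v + e * suc e * κ ≡ (e + e) * ω) (discQuot e g)
discQuot-weight c κ ω g g-weight e v Q≢0 = solveFor (weight c v) (begin
  weight c v + T + (ω + (e + e) * (κ * suc e))   ≡⟨ cong (λ x → weight c v + T + x) (sym sumB) ⟩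
  weight c v + sumTo N A + sumTo N B             ≡⟨ det-weight c N (sylvesterQuot e g) A B C A entries v det≢0 ⟩
  sumTo N C + sumTo N A                          ≡⟨ cong (_+ T) sumC ⟩
  N * ω + suc e * (κ * e) + T                    ∎)
  where
  N : ℕ
  N = e + suc e
  -- entry (r, s) has weight ω - κ(d + r - s) in the rows of g, ω - κ(r - s + 1) in those of g′,
  -- and 0 in column 0.
  A B C : ℕ → ℕ
  A r = κ * r
  B zero    = ω
  B (suc _) = κ * suc e
  C r = ω + rowOffset e (κ * e) r
  T : ℕ
  T = sumTo N A

  det≢0 : det N (sylvesterQuot e g) v ≢ + 0
  det≢0 = ·P-≢0 (discSign (suc e)) (det N (sylvesterQuot e g)) v Q≢0

  sumB : sumTo N B ≡ ω + (e + e) * (κ * suc e)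
  sumB = subst (λ n → sumTo n B ≡ ω + (e + e) * (κ * suc e)) (sym (ℕₚ.+-suc e e))
               (cong (λ x → ω + x) (sumTo-const (e + e) (κ * suc e)))

  sumC : sumTo N C ≡ N * ω + suc e * (κ * e)
  sumC = trans (sumTo-+ N (λ _ → ω) (rowOffset e (κ * e)))
               (cong₂ _+_ (sumTo-const N ω) (sumTo-rowOffset e (suc e) (κ * e)))

  solveFor : ∀ w → w + T + (ω + (e + e) * (κ * suc e)) ≡ N * ω + suc e * (κ * e) + T →
             w + e * suc e * κ ≡ (e + e) * ω
  solveFor w eq = ℕₚ.+-cancelʳ-≡ (ω + e * suc e * κ + T) _ _
    (trans (lhs w T e κ ω) (trans eq (rhs T e κ ω)))
    where
    lhs : ∀ w T e κ ω → w + e * suc e * κ + (ω + e * suc e * κ + T) ≡ w + T + (ω + (e + e) * (κ * suc e))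
    lhs = solve-∀
    rhs : ∀ T e κ ω → (e + suc e) * ω + suc e * (κ * e) + T ≡ (e + e) * ω + (ω + e * suc e * κ + T)
    rhs = solve-∀

  entries : ∀ r s → r < N → s < N →
            AllMonomials (λ v → weight c v + A r + B s ≡ C r + A s) (sylvesterQuot e g r s)
  entries r zero _ _ v entry≢0 with sylvesterQuot-col0-≢0 e g r v entry≢0
  ... | v≡0 , inj₁ (refl , 0<e) rewrite weight-zero c v v≡0 | rowOffset-< (κ * e) 0<e | ℕₚ.*-zeroʳ κ =
    sym (trans (ℕₚ.+-identityʳ (ω + 0)) (ℕₚ.+-identityʳ ω))
  ... | v≡0 , inj₂ refl rewrite weight-zero c v v≡0 | rowOffset-≥ (κ * e) (ℕₚ.≤-refl {e}) | ℕₚ.*-zeroʳ κ =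
    trans (ℕₚ.+-comm (κ * e) ω) (sym (ℕₚ.+-identityʳ (ω + κ * e)))
  entries r (suc s) _ _ v entry≢0 with sylvester-≢0 (suc e) g e (deriv g) r (suc s) v entry≢0
  ... | inj₁ (r<e , j , _ , j+s≡d+r , g≢0) rewrite rowOffset-< (κ * e) r<e = begin
    weight c v + κ * r + κ * suc e      ≡⟨ regroup₁ (weight c v) κ r (suc e) ⟩
    weight c v + κ * (suc e + r)         ≡⟨ cong (λ x → weight c v + κ * x) (sym j+s≡d+r) ⟩
    weight c v + κ * (j + suc s)         ≡⟨ regroup₂ (weight c v) κ j (suc s) ⟩
    weight c v + κ * j + 0 + κ * suc s   ≡⟨ cong (λ x → x + 0 + κ * suc s) (g-weight j v g≢0) ⟩
    ω + 0 + κ * suc s                    ∎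
    where
    regroup₁ : ∀ w κ r d → w + κ * r + κ * d ≡ w + κ * (d + r)
    regroup₁ = solve-∀
    regroup₂ : ∀ w κ j s → w + κ * (j + s) ≡ w + κ * j + 0 + κ * s
    regroup₂ = solve-∀
  ... | inj₂ (e≤r , j , _ , j+s≡r , g′≢0) rewrite rowOffset-≥ (κ * e) e≤r = begin
    weight c v + κ * r + κ * suc e                 ≡⟨ cong (λ x → weight c v + κ * x + κ * suc e) (sym j+s≡r) ⟩
    weight c v + κ * (j + suc s) + κ * suc e       ≡⟨ regroup (weight c v) κ j s e ⟩
    weight c v + κ * suc j + κ * e + κ * suc s     ≡⟨ cong (λ x → x + κ * e + κ * suc s) (g-weight (suc j) v g≢0′) ⟩
    ω + κ * e + κ * suc s                          ∎
    where
    g≢0′ : g (suc j) v ≢ + 0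
    g≢0′ = ·P-≢0 (+ suc j) (g (suc j)) v g′≢0
    regroup : ∀ w κ j s e → w + κ * (j + suc s) + κ * suc e ≡ w + κ * suc j + κ * e + κ * suc s
    regroup = solve-∀

Homogeneous : ∀ {m} → (Fin m → ℕ) → ℕ → Poly m → Set
Homogeneous c ω = AllMonomials (λ v → weight c v ≡ ω)

IsAffine : ∀ {m} → (Fin m → ℕ) → ℕ → ℕ → Set
IsAffine c α β = ∀ i → c i ≡ α + β * toℕ i

varP-≢0 : ∀ {m} (i : Fin m) v → varP i v ≢ + 0 → v ≡ replicate m 0 [ i ]≔ 1
varP-≢0 {m} i v var≢0 with ≡-dec ℕ._≟_ v (replicate m 0 [ i ]≔ 1)
... | yes v≡eᵢ = v≡eᵢ
... | no  _    = ⊥-elim (var≢0 refl)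

genericCoeff-homogeneous : ∀ {n} {c : Fin (suc n) → ℕ} α β → IsAffine c α β →
                           ∀ j → Homogeneous c (α + β * j) (genericCoeff n j)
genericCoeff-homogeneous {n} {c} α β affine j v coeff≢0 with j ℕ.<? suc n
... | yes j<  = begin
  weight c v                                      ≡⟨ cong (weight c) (varP-≢0 (Fin.fromℕ< j<) v coeff≢0) ⟩
  weight c (replicate (suc n) 0 [ Fin.fromℕ< j< ]≔ 1) ≡⟨ weight-unit c (Fin.fromℕ< j<) ⟩
  c (Fin.fromℕ< j<)                               ≡⟨ affine (Fin.fromℕ< j<) ⟩
  α + β * toℕ (Fin.fromℕ< j<)                     ≡⟨ cong (λ i → α + β * i) (Finₚ.toℕ-fromℕ< j<) ⟩
  α + β * j                                       ∎
... | no  _   = ⊥-elim (coeff≢0 refl)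

resultant-generic-weight : ∀ e₀ {c : Fin (suc (suc e₀)) → ℕ} α β → IsAffine c α β →
  let n = suc e₀ ; f = genericCoeff n in
  AllMonomials (λ v → weight c v + n * (β * e₀) ≡ (e₀ + n) * (α + β * n)) (resultant n f e₀ (deriv f))
resultant-generic-weight e₀ {c} α β affine v res≢0 = ℕₚ.+-cancelʳ-≡ S _ _ (begin
  weight c v + n * (β * e₀) + S              ≡⟨ cong (λ x → weight c v + x + S) (sym (sumTo-rowOffset e₀ n (β * e₀))) ⟩
  weight c v + sumTo N A + sumTo N B        ≡⟨ det-weight c N (sylvester n f e₀ (deriv f)) A B C E entries v res≢0 ⟩
  sumTo N C + sumTo N E                     ≡⟨ cong₂ _+_ sumC (trans (sumTo-const N 0) (ℕₚ.*-zeroʳ N)) ⟩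
  N * (α + β * n) + S + 0                   ≡⟨ ℕₚ.+-identityʳ _ ⟩
  N * (α + β * n) + S                       ∎)
  where
  n N : ℕ
  n = suc e₀
  N = e₀ + n
  f : ℕ → Poly (suc n)
  f = genericCoeff n
  A B C E : ℕ → ℕ
  A = rowOffset e₀ (β * e₀)
  B s = β * s
  C r = α + β * n + β * r
  E _ = 0
  S : ℕ
  S = sumTo N B

  sumC : sumTo N C ≡ N * (α + β * n) + S
  sumC = trans (sumTo-+ N (λ _ → α + β * n) B) (cong (_+ S) (sumTo-const N (α + β * n)))

  entries : ∀ r s → r < N → s < N →
            AllMonomials (λ v → weight c v + A r + B s ≡ C r + E s) (sylvester n f e₀ (deriv f) r s)
  entries r s _ _ v entry≢0 with sylvester-≢0 n f e₀ (deriv f) r s v entry≢0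
  ... | inj₁ (r<e₀ , j , _ , j+s≡n+r , f≢0) rewrite rowOffset-< (β * e₀) r<e₀ = begin
    weight c v + 0 + β * s               ≡⟨ cong (λ w → w + 0 + β * s) (genericCoeff-homogeneous α β affine j v f≢0) ⟩
    α + β * j + 0 + β * s                ≡⟨ regroup α β j s ⟩
    α + β * (j + s) + 0                  ≡⟨ cong (λ x → α + β * x + 0) j+s≡n+r ⟩
    α + β * (n + r) + 0                  ≡⟨ regroup′ α β n r ⟩
    α + β * n + β * r + 0                ∎
    where
    regroup : ∀ α β j s → α + β * j + 0 + β * s ≡ α + β * (j + s) + 0
    regroup = solve-∀
    regroup′ : ∀ α β n r → α + β * (n + r) + 0 ≡ α + β * n + β * r + 0
    regroup′ = solve-∀
  ... | inj₂ (e₀≤r , j , _ , j+s≡r , f′≢0) rewrite rowOffset-≥ (β * e₀) e₀≤r = begin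
    weight c v + β * e₀ + β * s          ≡⟨ cong (λ w → w + β * e₀ + β * s) (genericCoeff-homogeneous α β affine (suc j) v f≢0) ⟩
    α + β * suc j + β * e₀ + β * s       ≡⟨ regroup α β j e₀ s ⟩
    α + β * n + β * (j + s) + 0          ≡⟨ cong (λ x → α + β * n + β * x + 0) j+s≡r ⟩
    α + β * n + β * r + 0                ∎
    where
    f≢0 : f (suc j) v ≢ + 0
    f≢0 = ·P-≢0 (+ suc j) (f (suc j)) v f′≢0
    regroup : ∀ α β j e₀ s → α + β * suc j + β * e₀ + β * s ≡ α + β * suc e₀ + β * (j + s) + 0
    regroup = solve-∀

weightOfD : ℕ → ℕ → ℕ → ℕ
weightOfD e₀ α β = (e₀ + e₀) * α + suc e₀ * e₀ * β

D-homogeneous : ∀ e₀ {c : Fin (suc (suc e₀)) → ℕ} α β → IsAffine c α β →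
                Homogeneous c (weightOfD e₀ α β) (D (suc e₀))
D-homogeneous e₀ {c} α β affine u D≢0 = ℕₚ.+-cancelʳ-≡ (γ + n * (β * e₀)) _ _ (begin
  weight c u + (γ + n * (β * e₀))       ≡⟨ sym (ℕₚ.+-assoc (weight c u) γ _) ⟩
  weight c u + γ + n * (β * e₀)         ≡⟨ cong (_+ n * (β * e₀)) (sym weight-bumpLast) ⟩
  weight c (bumpLast u) + n * (β * e₀)  ≡⟨ resultant-generic-weight e₀ α β affine (bumpLast u) res≢0 ⟩
  (e₀ + n) * γ                          ≡⟨ split e₀ α β ⟩
  (e₀ + e₀) * α + n * e₀ * β + (γ + n * (β * e₀)) ∎)
  where
  n γ : ℕ
  n = suc e₀
  γ = α + β * n
  f : ℕ → Poly (suc n)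
  f = genericCoeff n

  res≢0 : resultant n f e₀ (deriv f) (bumpLast u) ≢ + 0
  res≢0 = ·P-≢0 (discSign n) (resultant n f e₀ (deriv f)) (bumpLast u) D≢0

  weight-bumpLast : weight c (bumpLast u) ≡ weight c u + γ
  weight-bumpLast = trans (weight-updateAt-suc c (Fin.fromℕ n) u)
    (cong (λ x → weight c u + x) (trans (affine (Fin.fromℕ n)) (cong (λ i → α + β * i) (Finₚ.toℕ-fromℕ n))))

  split : ∀ e₀ α β → (e₀ + suc e₀) * (α + β * suc e₀) ≡
                     (e₀ + e₀) * α + suc e₀ * e₀ * β + (α + β * suc e₀ + suc e₀ * (β * e₀))
  split = solve-∀

coeffIn-weight : ∀ {n} {c : Fin (suc n) → ℕ} {ω p} k → Homogeneous c ω p →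
                 ∀ j → AllMonomials (λ v → weight (zeroAt k c) v + c k * j ≡ ω) (coeffIn k p j)
coeffIn-weight {c = c} k p-hom j v coeff≢0 with lookup v k ≡ᵇ 0
... | true  = trans (sym (weight-updateAt c k (const j) v)) (p-hom (v [ k ]≔ j) coeff≢0)
... | false = ⊥-elim (coeff≢0 refl)

≡ᵇ-true : ∀ {m n} → m ≡ n → (m ≡ᵇ n) ≡ true
≡ᵇ-true {m} {n} m≡n with m ≡ᵇ n | ℕₚ.≡⇒≡ᵇ m n m≡n
... | true | _ = refl

≡ᵇ-false : ∀ {m n} → m ≢ n → (m ≡ᵇ n) ≡ false
≡ᵇ-false {m} {n} m≢n with m ≡ᵇ n | ℕₚ.≡ᵇ⇒≡ m n
... | true  | m≡n = ⊥-elim (m≢n (m≡n _))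
... | false | _   = refl

∸-eq : ∀ y z {x} → y + z ≡ x → x ∸ y ≡ z
∸-eq y z refl = ℕₚ.m+n∸m≡n y z

degD-end : ∀ n k → isEnd n k ≡ true → degD n k ≡ n ∸ 1
degD-end n k end = cong (λ b → if b then n ∸ 1 else n) end

degD-interior : ∀ n k → isEnd n k ≡ false → degD n k ≡ n
degD-interior n k interior = cong (λ b → if b then n ∸ 1 else n) interior

expectedDeg-end : ∀ n k → isEnd n k ≡ true → expectedDeg n k ≡ (3 * n ∸ 6) * (n ∸ 1)
expectedDeg-end n k end = cong (λ b → if b then (3 * n ∸ 6) * (n ∸ 1) else (3 * n ∸ 4) * (n ∸ 1)) end

expectedDeg-interior : ∀ n k → isEnd n k ≡ false → expectedDeg n k ≡ (3 * n ∸ 4) * (n ∸ 1)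
expectedDeg-interior n k interior =
  cong (λ b → if b then (3 * n ∸ 6) * (n ∸ 1) else (3 * n ∸ 4) * (n ∸ 1)) interior

interior-weight : ∀ {m} t → t ≤ m →
  (2 + m) * suc m * (2 * (2 + m) ∸ suc t ∸ 2) + suc m * (2 + m) * suc t ≡ (suc m + suc m) * weightOfD (suc m) 0 1
interior-weight {m} t t≤m with m ∸ t | ℕₚ.m+[n∸m]≡n t≤m
... | u | refl = trans (cong (λ x → (2 + m) * suc m * (x ∸ 2) + suc m * (2 + m) * suc t) (∸-eq (suc t) (3 + (t + u + u)) (expand t u)))
                       (collect t u)
  where
  expand : ∀ t u → suc t + (3 + (t + u + u)) ≡ 2 * (2 + (t + u))
  expand = solve-∀
  collect : ∀ t u → (2 + (t + u)) * suc (t + u) * suc (t + u + u) + suc (t + u) * (2 + (t + u)) * suc t ≡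
                    (suc (t + u) + suc (t + u)) * ((suc (t + u) + suc (t + u)) * 0 + (2 + (t + u)) * suc (t + u) * 1)
  collect = solve-∀

module _ (m : ℕ) where

  private
    n : ℕ
    n = 2 + m

  record Numerology (k : Fin (suc n)) : Set where
    field
      e               : ℕ
      degD≡           : degD n k ≡ suc e
      expectedDeg≡    : expectedDeg n k + e * suc e * 1 ≡ (e + e) * weightOfD (suc m) 1 0
      expectedWeight≡ : expectedWeight n k + e * suc e * toℕ k ≡ (e + e) * weightOfD (suc m) 0 1

  endpoint-deg : (3 * n ∸ 6) * suc m + m * suc m * 1 ≡ (m + m) * weightOfD (suc m) 1 0
  endpoint-deg = trans (cong (λ x → x * suc m + m * suc m * 1) (∸-eq 6 (3 * m) (expand m))) (collect m)
    where
    expand : ∀ m → 6 + 3 * m ≡ 3 * (2 + m)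
    expand = solve-∀
    collect : ∀ m → 3 * m * suc m + m * suc m * 1 ≡ (m + m) * ((suc m + suc m) * 1 + (2 + m) * suc m * 0)
    collect = solve-∀

  numerology-bottom : Numerology zero
  numerology-bottom = record
    { e               = m
    ; degD≡           = refl
    ; expectedDeg≡    = endpoint-deg
    ; expectedWeight≡ = trans (cong (λ x → n * suc m * x + m * suc m * 0) (∸-eq 4 (m + m) (expand m))) (collect m)
    }
    where
    expand : ∀ m → 4 + (m + m) ≡ 2 * (2 + m)
    expand = solve-∀
    collect : ∀ m → (2 + m) * suc m * (m + m) + m * suc m * 0 ≡ (m + m) * ((suc m + suc m) * 0 + (2 + m) * suc m * 1)
    collect = solve-∀

  numerology-top : Numerology (Fin.fromℕ n)
  numerology-top = record
    { e               = m
    ; degD≡           = degD-end n (Fin.fromℕ n) top-isEnd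
    ; expectedDeg≡    = trans (cong (_+ m * suc m * 1) (expectedDeg-end n (Fin.fromℕ n) top-isEnd)) endpoint-deg
    ; expectedWeight≡ = trans (cong (λ κ → n * suc m * (2 * n ∸ κ ∸ 2) + m * suc m * κ) (Finₚ.toℕ-fromℕ n))
                              (trans (cong (λ x → n * suc m * (x ∸ 2) + m * suc m * n) (∸-eq n n (expand m))) (collect m))
    }
    where
    top-isEnd : isEnd n (Fin.fromℕ n) ≡ true
    top-isEnd = trans (cong (λ b → (toℕ (Fin.fromℕ n) ≡ᵇ 0) ∨ b) (≡ᵇ-true (Finₚ.toℕ-fromℕ n)))
                      (Boolₚ.∨-zeroʳ (toℕ (Fin.fromℕ n) ≡ᵇ 0))
    expand : ∀ m → (2 + m) + (2 + m) ≡ 2 * (2 + m)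
    expand = solve-∀
    collect : ∀ m → (2 + m) * suc m * m + m * suc m * (2 + m) ≡ (m + m) * ((suc m + suc m) * 0 + (2 + m) * suc m * 1)
    collect = solve-∀

  numerology-interior : ∀ j → Numerology (suc (Fin.inject₁ j))
  numerology-interior j = record
    { e               = suc m
    ; degD≡           = degD-interior n k interior-isEnd
    ; expectedDeg≡    = trans (cong (_+ suc m * n * 1) (expectedDeg-interior n k interior-isEnd))
                              (trans (cong (λ x → x * suc m + suc m * n * 1) (∸-eq 4 (3 * m + 2) (expand m))) (collect m))
    ; expectedWeight≡ = interior-weight t t≤m
    }
    where
    k : Fin (suc n)
    k = suc (Fin.inject₁ j)
    t : ℕ
    t = toℕ (Fin.inject₁ j)
    interior-isEnd : isEnd n k ≡ false
    interior-isEnd = ≡ᵇ-false (λ t≡ → Finₚ.toℕ-inject₁-≢ j (sym t≡))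
    t≤m : t ≤ m
    t≤m = ℕₚ.≤-pred (subst (_< suc m) (sym (Finₚ.toℕ-inject₁ j)) (Finₚ.toℕ<n j))
    expand : ∀ m → 4 + (3 * m + 2) ≡ 3 * (2 + m)
    expand = solve-∀
    collect : ∀ m → (3 * m + 2) * suc m + suc m * (2 + m) * 1 ≡ (suc m + suc m) * ((suc m + suc m) * 1 + (2 + m) * suc m * 0)
    collect = solve-∀

numerology : ∀ m k → Numerology m k
numerology m k with Top.view k
... | ‵fromℕ                = numerology-top m
... | ‵inj₁ {i = zero}  _   = numerology-bottom m
... | ‵inj₁ {i = suc j} _   = numerology-interior m j

lemma3p1 : (n : ℕ) → 2 ≤ n → (k : Fin (suc n)) →
    ∃ λ (DD : Poly (suc n)) → IsDD n k DD ×
      ((e : Vec ℕ (suc n)) → DD e ≢ + 0 →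
        (degOff k e ≡ expectedDeg n k) × (weightOff k e ≡ expectedWeight n k))
lemma3p1 (suc (suc m)) (s≤s (s≤s z≤n)) k =
  discQuot e g , subst (λ d → IsDisc d g (discQuot e g)) (sym degD≡) (discQuot-isDisc e g) , λ v DD≢0 →
    trans (degOff-weight k v) (cancel (deg v DD≢0) expectedDeg≡) ,
    trans (weightOff-weight k v) (cancel (wt v DD≢0) expectedWeight≡)
  where
  open Numerology (numerology m k)
  g : ℕ → Poly (suc (suc (suc m)))
  g = coeffIn k (D (suc (suc m)))
  cancel : ∀ {x y z w} → x + w ≡ z → y + w ≡ z → x ≡ y
  cancel {w = w} x+w≡z y+w≡z = ℕₚ.+-cancelʳ-≡ w _ _ (trans x+w≡z (sym y+w≡z))
  deg : AllMonomials (λ v → weight (zeroAt k (λ _ → 1)) v + e * suc e * 1 ≡ (e + e) * weightOfD (suc m) 1 0)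
                     (discQuot e g)
  deg = discQuot-weight (zeroAt k (λ _ → 1)) 1 (weightOfD (suc m) 1 0) g
          (coeffIn-weight k (D-homogeneous (suc m) 1 0 (λ _ → refl))) e
  wt : AllMonomials (λ v → weight (zeroAt k toℕ) v + e * suc e * toℕ k ≡ (e + e) * weightOfD (suc m) 0 1)
                    (discQuot e g)
  wt = discQuot-weight (zeroAt k toℕ) (toℕ k) (weightOfD (suc m) 0 1) g
         (coeffIn-weight k (D-homogeneous (suc m) 0 1 (λ i → sym (ℕₚ.*-identityˡ (toℕ i))))) e
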